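{- Let $Q$ be a positive integer, let $x$ be the least common multiple of $1,2,\dots,Q$, and let $X=(X_{mn})_{m,n=1}^x$ with $X_{mn}=\sum_{q=1}^Q c_q(m-n)$. Then for every positive integer $j$, $\mathrm{tr}(X^j)=x^j\Phi(Q)$.
   Context: For a positive integer $q$ and any integer $n$, the Ramanujan sum is $c_q(n)=\sum_{1\le k\le q,\ \gcd(k,q)=1}\exp(2\pi i kn/q)$. $\varphi$ is Euler's totient function and $\Phi(Q)=\sum_{q=1}^Q\varphi(q)$; $\mathrm{tr}$ denotes the trace. -}

module Defs where

open import Level using (Level)
open import Data.Nat as ℕ using (ℕ; zero; suc; _≤_; _<_)
open import Data.Nat.GCD using (gcd)
open import Data.Nat.LCM using (lcm)
open import Data.Integer as ℤ using (ℤ; +_; _%ℕ_)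
open import Relation.Nullary using (Dec; yes; no; ¬_)
open import Data.Sum using (_⊎_)
open import Algebra.Bundles using (CommutativeRing)

lcmUpTo : ℕ → ℕ
lcmUpTo zero    = 1
lcmUpTo (suc Q) = lcm (suc Q) (lcmUpTo Q)

φ : ℕ → ℕ
φ q = go q
  where
  go : ℕ → ℕ
  go zero = 0
  go (suc k) with gcd (suc k) q ℕ.≟ 1
  ... | yes _ = suc (go k)
  ... | no  _ = go k

Φ : ℕ → ℕ
Φ zero    = 0
Φ (suc Q) = φ (suc Q) ℕ.+ Φ Q

divN : ℕ → ℕ → ℕ
divN a zero    = 0
divN a (suc d) = a ℕ./ suc d

modZ : ℤ → ℕ → ℕ
modZ a zero    = 0
modZ a (suc d) = a %ℕ suc d

module RingDefs {c ℓ : Level} (R : CommutativeRing c ℓ) where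
  open CommutativeRing R

  natR : ℕ → Carrier
  natR zero    = 0#
  natR (suc n) = 1# + natR n

  powR : Carrier → ℕ → Carrier
  powR a zero    = 1#
  powR a (suc n) = a * powR a n

  sumR : ℕ → (ℕ → Carrier) → Carrier
  sumR zero    f = 0#
  sumR (suc n) f = sumR n f + f (suc n)

  CharZero : Set ℓ
  CharZero = ∀ n → ¬ (natR (suc n) ≈ 0#)

  IsDomain : Set (c Level.⊔ ℓ)
  IsDomain = ∀ a b → a * b ≈ 0# → (a ≈ 0#) ⊎ (b ≈ 0#)

  IsPrimitiveRoot : Carrier → ℕ → Set ℓ
  IsPrimitiveRoot ζ N = (powR ζ N ≈ 1#) × (∀ d → 1 ≤ d → d < N → ¬ (powR ζ d ≈ 1#))
    where open import Data.Product using (_×_)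

  -- Given a primitive N-th root of unity ζ (playing the role of exp(2πi/N)),
  -- with q ∣ N:  exp(2πi·a/q) = ζ^{((N/q)·a) mod N}.
  eq : Carrier → ℕ → ℕ → ℤ → Carrier
  eq ζ N q a = powR ζ (modZ (+ (divN N q) ℤ.* a) N)

  ramanujan : Carrier → ℕ → ℕ → ℤ → Carrier
  ramanujan ζ N q n = sumR q term
    where
    term : ℕ → Carrier
    term k with gcd k q ℕ.≟ 1
    ... | yes _ = eq ζ N q (+ k ℤ.* n)
    ... | no  _ = 0#

  -- matrices indexed by 1..N, represented as functions ℕ → ℕ → Carrier
  Mat : Set c
  Mat = ℕ → ℕ → Carrier

  matMul : ℕ → Mat → Mat → Mat
  matMul N A B m n = sumR N (λ l → A m l * B l n)

  idMat : Mat
  idMat m n with m ℕ.≟ n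
  ... | yes _ = 1#
  ... | no  _ = 0#

  matPow : ℕ → Mat → ℕ → Mat
  matPow N A zero    = idMat
  matPow N A (suc j) = matMul N A (matPow N A j)

  trace : ℕ → Mat → Carrier
  trace N A = sumR N (λ i → A i i)

  X : Carrier → ℕ → Mat
  X ζ Q m n = sumR Q (λ q → ramanujan ζ (lcmUpTo Q) q (+ m ℤ.- + n))

{-# OPTIONS --safe #-}
module Submission where

-- Let N = lcm(1,…,Q) and χ(z) = ζ^z, so that e(a/q) = χ((N/q) a). Then
-- X(m,n) = Σ χ(f (m − n)), summed over the frequencies f = (N/q) k of the reduced fractions
-- k/q with 1 ≤ k ≤ q ≤ Q; these frequencies lie in [1, N] and are pairwise distinct.
-- As ζ is primitive and R is a domain, Σ_{l=1}^N χ((b − a) l) = 0 for distinct a, b ∈ [1, N],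
-- so the characters of different frequencies are orthogonal and X² = N X.
-- Hence X^j = N^(j−1) X, and tr X = N Φ(Q) since every diagonal entry is Σ_{q ≤ Q} φ(q).

open import Defs
open import Level using (Level)
open import Function using (_∘_)
open import Data.Nat as ℕ using (ℕ; zero; suc; z≤n; s≤s; _≤_; _<_; NonZero)
import Data.Nat.Properties as ℕP
import Data.Nat.DivMod as ℕD
open import Data.Nat.Divisibility using (_∣_; ∣-antisym; ∣-trans; 0∣⇒≡0; n∣m*n)
open import Data.Nat.GCD using (gcd)
open import Data.Nat.LCM using (lcm; gcd*lcm; m∣lcm[m,n]; n∣lcm[m,n])
open import Data.Nat.Coprimality as Coprime
  using (Coprime; coprime?; gcd≡1⇒coprime; coprime⇒gcd≡1; coprime-divisor)
open import Data.Nat.Solver using () renaming (module +-*-Solver to ℕSolver)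
open import Data.Integer as ℤ using (ℤ; +_; -[1+_])
import Data.Integer.Properties as ℤP
import Data.Integer.DivMod as ℤD
open import Data.Integer.Solver using (module +-*-Solver)
open import Data.Product using (_,_; proj₁; proj₂)
open import Data.Empty using (⊥-elim)
open import Data.Sum using (inj₁; inj₂; [_,_]′)
open import Relation.Nullary using (¬_; yes; no; contradiction)
open import Relation.Binary.Definitions using (tri<; tri≈; tri>)
open import Relation.Binary.PropositionalEquality as ≡ using (_≡_; _≢_)
open import Algebra.Bundles using (CommutativeRing)

module Sums {c ℓ : Level} (R : CommutativeRing c ℓ) where
  open CommutativeRing R
  open RingDefs R using (natR; powR; sumR; IsDomain)
  open import Algebra.Properties.Ring ring using (+-cancelʳ; x∙y⁻¹≈ε⇒x≈y; [y-z]x≈yx-zx)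
  open import Algebra.Properties.CommutativeSemigroup +-commutativeSemigroup using (interchange)
  open import Relation.Binary.Reasoning.Setoid setoid

  sumR-cong : ∀ n {f g : ℕ → Carrier} → (∀ k → 1 ≤ k → k ≤ n → f k ≈ g k) → sumR n f ≈ sumR n g
  sumR-cong zero    f≈g = refl
  sumR-cong (suc n) f≈g = +-cong (sumR-cong n (λ k 1≤k k≤n → f≈g k 1≤k (ℕP.m≤n⇒m≤1+n k≤n)))
                                 (f≈g (suc n) (s≤s z≤n) ℕP.≤-refl)

  sumR-zero : ∀ n {f : ℕ → Carrier} → (∀ k → 1 ≤ k → k ≤ n → f k ≈ 0#) → sumR n f ≈ 0#
  sumR-zero n f≈0 = trans (sumR-cong n f≈0) (zeros n)
    where
    zeros : ∀ n → sumR n (λ _ → 0#) ≈ 0#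
    zeros zero    = refl
    zeros (suc n) = trans (+-identityʳ _) (zeros n)

  sumR-single : ∀ n {f : ℕ → Carrier} a → 1 ≤ a → a ≤ n →
                (∀ k → 1 ≤ k → k ≤ n → k ≢ a → f k ≈ 0#) → sumR n f ≈ f a
  sumR-single zero    a 1≤a a≤0 _ = contradiction (ℕP.≤-trans 1≤a a≤0) λ ()
  sumR-single (suc n) a 1≤a a≤1+n others with a ℕ.≟ suc n
  ... | yes ≡.refl = trans (+-cong lower refl) (+-identityˡ _)
    where
    lower = sumR-zero n (λ k 1≤k k≤n → others k 1≤k (ℕP.m≤n⇒m≤1+n k≤n) (ℕP.<⇒≢ (s≤s k≤n)))
  ... | no a≢1+n = trans (+-cong rest top) (+-identityʳ _)
    where
    rest = sumR-single n a 1≤a (ℕP.≤-pred (ℕP.≤∧≢⇒< a≤1+n a≢1+n))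
                       (λ k 1≤k k≤n → others k 1≤k (ℕP.m≤n⇒m≤1+n k≤n))
    top  = others (suc n) (s≤s z≤n) ℕP.≤-refl (a≢1+n ∘ ≡.sym)

  sumR-+ : ∀ n (f g : ℕ → Carrier) → sumR n (λ i → f i + g i) ≈ sumR n f + sumR n g
  sumR-+ zero    f g = sym (+-identityʳ 0#)
  sumR-+ (suc n) f g = trans (+-cong (sumR-+ n f g) refl) (interchange _ _ _ _)

  sumR-distribˡ : ∀ n a (f : ℕ → Carrier) → a * sumR n f ≈ sumR n (λ i → a * f i)
  sumR-distribˡ zero    a f = zeroʳ a
  sumR-distribˡ (suc n) a f = trans (distribˡ a _ _) (+-cong (sumR-distribˡ n a f) refl)

  sumR-distribʳ : ∀ n a (f : ℕ → Carrier) → sumR n f * a ≈ sumR n (λ i → f i * a)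
  sumR-distribʳ n a f =
    trans (*-comm _ a) (trans (sumR-distribˡ n a f) (sumR-cong n (λ i _ _ → *-comm a (f i))))

  sumR-swap : ∀ n m (f : ℕ → ℕ → Carrier) →
              sumR n (λ i → sumR m (f i)) ≈ sumR m (λ j → sumR n (λ i → f i j))
  sumR-swap zero    m f = sym (sumR-zero m (λ _ _ _ → refl))
  sumR-swap (suc n) m f = trans (+-cong (sumR-swap n m f) refl) (sym (sumR-+ m _ _))

  sumR-const : ∀ n a → sumR n (λ _ → a) ≈ natR n * a
  sumR-const zero    a = sym (zeroˡ a)
  sumR-const (suc n) a = begin
    sumR n (λ _ → a) + a  ≈⟨ +-cong (sumR-const n a) (sym (*-identityˡ a)) ⟩
    natR n * a + 1# * a   ≈⟨ distribʳ a _ _ ⟨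
    (natR n + 1#) * a     ≈⟨ *-cong (+-comm _ _) refl ⟩
    (1# + natR n) * a     ∎

  natR-+ : ∀ m n → natR (m ℕ.+ n) ≈ natR m + natR n
  natR-+ zero    n = sym (+-identityˡ _)
  natR-+ (suc m) n = trans (+-cong refl (natR-+ m n)) (sym (+-assoc _ _ _))

  natR-* : ∀ m n → natR (m ℕ.* n) ≈ natR m * natR n
  natR-* zero    n = sym (zeroˡ _)
  natR-* (suc m) n = begin
    natR (n ℕ.+ m ℕ.* n)           ≈⟨ natR-+ n (m ℕ.* n) ⟩
    natR n + natR (m ℕ.* n)        ≈⟨ +-cong (sym (*-identityˡ _)) (natR-* m n) ⟩
    1# * natR n + natR m * natR n  ≈⟨ distribʳ _ _ _ ⟨
    (1# + natR m) * natR n         ∎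

  natR-^ : ∀ m n → natR (m ℕ.^ n) ≈ powR (natR m) n
  natR-^ m zero    = +-identityʳ 1#
  natR-^ m (suc n) = trans (natR-* m (m ℕ.^ n)) (*-cong refl (natR-^ m n))

  powR-+ : ∀ u m n → powR u (m ℕ.+ n) ≈ powR u m * powR u n
  powR-+ u zero    n = sym (*-identityˡ _)
  powR-+ u (suc m) n = trans (*-cong refl (powR-+ u m n)) (sym (*-assoc _ _ _))

  powR-*-≈1 : ∀ u n → powR u n ≈ 1# → ∀ t → powR u (t ℕ.* n) ≈ 1#
  powR-*-≈1 u n uⁿ≈1 zero    = refl
  powR-*-≈1 u n uⁿ≈1 (suc t) =
    trans (powR-+ u n (t ℕ.* n)) (trans (*-cong uⁿ≈1 (powR-*-≈1 u n uⁿ≈1 t)) (*-identityˡ 1#))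

  sumR-powR-shift : ∀ u n → u * sumR n (powR u) + u ≈ sumR n (powR u) + powR u (suc n)
  sumR-powR-shift u zero    = +-cong (zeroʳ u) (sym (*-identityʳ u))
  sumR-powR-shift u (suc n) = begin
    u * (S + powR u (suc n)) + u                 ≈⟨ +-cong (distribˡ u S _) refl ⟩
    (u * S + powR u (suc (suc n))) + u           ≈⟨ +-assoc _ _ _ ⟩
    u * S + (powR u (suc (suc n)) + u)           ≈⟨ +-cong refl (+-comm _ _) ⟩
    u * S + (u + powR u (suc (suc n)))           ≈⟨ +-assoc _ _ _ ⟨
    (u * S + u) + powR u (suc (suc n))           ≈⟨ +-cong (sumR-powR-shift u n) refl ⟩
    (S + powR u (suc n)) + powR u (suc (suc n))  ∎
    where S = sumR n (powR u)

  sumR-powR≈0 : IsDomain → ∀ n u → powR u n ≈ 1# → ¬ u ≈ 1# → sumR n (powR u) ≈ 0#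
  sumR-powR≈0 domain n u uⁿ≈1 u≉1 with domain (u - 1#) S [u-1]S≈0
    where
    S = sumR n (powR u)
    uS≈S : u * S ≈ S
    uS≈S = +-cancelʳ u _ _
      (trans (sumR-powR-shift u n) (+-cong refl (trans (*-cong refl uⁿ≈1) (*-identityʳ u))))
    [u-1]S≈0 : (u - 1#) * S ≈ 0#
    [u-1]S≈0 = begin
      (u - 1#) * S    ≈⟨ [y-z]x≈yx-zx S u 1# ⟩
      u * S - 1# * S  ≈⟨ +-cong uS≈S (-‿cong (*-identityˡ S)) ⟩
      S - S           ≈⟨ -‿inverseʳ S ⟩
      0#              ∎
  ... | inj₁ u-1≈0 = contradiction (x∙y⁻¹≈ε⇒x≈y u 1# u-1≈0) u≉1
  ... | inj₂ S≈0   = S≈0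

  sumTriangle : ℕ → (ℕ → ℕ → Carrier) → Carrier
  sumTriangle Q f = sumR Q (λ q → sumR q (f q))

  sumTriangle-cong : ∀ Q {f g : ℕ → ℕ → Carrier} →
                     (∀ q k → 1 ≤ k → k ≤ q → q ≤ Q → f q k ≈ g q k) →
                     sumTriangle Q f ≈ sumTriangle Q g
  sumTriangle-cong Q f≈g =
    sumR-cong Q (λ q _ q≤Q → sumR-cong q (λ k 1≤k k≤q → f≈g q k 1≤k k≤q q≤Q))

  sumTriangle-single : ∀ Q {f : ℕ → ℕ → Carrier} q k → 1 ≤ k → k ≤ q → q ≤ Q →
                       (∀ q′ k′ → 1 ≤ k′ → k′ ≤ q′ → q′ ≤ Q →
                          (q′ , k′) ≢ (q , k) → f q′ k′ ≈ 0#) →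
                       sumTriangle Q f ≈ f q k
  sumTriangle-single Q {f} q k 1≤k k≤q q≤Q others = begin
    sumTriangle Q f  ≈⟨ sumR-single Q q (ℕP.≤-trans 1≤k k≤q) q≤Q otherRows ⟩
    sumR q (f q)     ≈⟨ sumR-single q k 1≤k k≤q otherColumns ⟩
    f q k            ∎
    where
    otherRows : ∀ q′ → 1 ≤ q′ → q′ ≤ Q → q′ ≢ q → sumR q′ (f q′) ≈ 0#
    otherRows q′ _ q′≤Q q′≢q = sumR-zero q′ (λ k′ 1≤k′ k′≤q′ →
      others q′ k′ 1≤k′ k′≤q′ q′≤Q (q′≢q ∘ ≡.cong proj₁))
    otherColumns : ∀ k′ → 1 ≤ k′ → k′ ≤ q → k′ ≢ k → f q k′ ≈ 0#
    otherColumns k′ 1≤k′ k′≤q k′≢k = others q k′ 1≤k′ k′≤q q≤Q (k′≢k ∘ ≡.cong proj₂)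

  sumTriangle-distribˡ : ∀ Q a (f : ℕ → ℕ → Carrier) →
                         a * sumTriangle Q f ≈ sumTriangle Q (λ q k → a * f q k)
  sumTriangle-distribˡ Q a f =
    trans (sumR-distribˡ Q a _) (sumR-cong Q (λ q _ _ → sumR-distribˡ q a _))

  sumTriangle-distribʳ : ∀ Q a (f : ℕ → ℕ → Carrier) →
                         sumTriangle Q f * a ≈ sumTriangle Q (λ q k → f q k * a)
  sumTriangle-distribʳ Q a f =
    trans (sumR-distribʳ Q a _) (sumR-cong Q (λ q _ _ → sumR-distribʳ q a _))

  sumTriangle-* : ∀ Q (f g : ℕ → ℕ → Carrier) →
                  sumTriangle Q f * sumTriangle Q g ≈
                  sumTriangle Q (λ q k → sumTriangle Q (λ q′ k′ → f q k * g q′ k′))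
  sumTriangle-* Q f g = trans (sumTriangle-distribʳ Q _ f)
    (sumTriangle-cong Q (λ q k _ _ _ → sumTriangle-distribˡ Q (f q k) g))

  sumR-sumTriangle : ∀ n Q (f : ℕ → ℕ → ℕ → Carrier) →
                     sumR n (λ l → sumTriangle Q (f l)) ≈ sumTriangle Q (λ q k → sumR n (λ l → f l q k))
  sumR-sumTriangle n Q f = trans (sumR-swap n Q _) (sumR-cong Q (λ q _ _ → sumR-swap n q _))

module Matrices {c ℓ : Level} (R : CommutativeRing c ℓ) where
  open CommutativeRing R
  open RingDefs R using (powR; sumR; matMul; idMat; matPow; trace)
  open Sums R
  open import Algebra.Properties.CommutativeSemigroup *-commutativeSemigroup using (x∙yz≈y∙xz)
  open import Relation.Binary.Reasoning.Setoid setoid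

  matMul-idMatʳ : ∀ N A m n → 1 ≤ n → n ≤ N → matMul N A idMat m n ≈ A m n
  matMul-idMatʳ N A m n 1≤n n≤N = trans (sumR-single N n 1≤n n≤N offDiagonal) (diagonal n)
    where
    offDiagonal : ∀ l → 1 ≤ l → l ≤ N → l ≢ n → A m l * idMat l n ≈ 0#
    offDiagonal l _ _ l≢n with l ℕ.≟ n
    ... | yes l≡n = contradiction l≡n l≢n
    ... | no  _   = zeroʳ _
    diagonal : ∀ l → A m l * idMat l l ≈ A m l
    diagonal l with l ℕ.≟ l
    ... | yes _   = *-identityʳ _
    ... | no  l≢l = contradiction ≡.refl l≢l

  A²≈aA⇒Aʲ⁺¹≈aʲA : ∀ N A a → (∀ m n → matMul N A A m n ≈ a * A m n) →
                   ∀ j m n → 1 ≤ n → n ≤ N → matPow N A (suc j) m n ≈ powR a j * A m n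
  A²≈aA⇒Aʲ⁺¹≈aʲA N A a A²≈aA zero    m n 1≤n n≤N =
    trans (matMul-idMatʳ N A m n 1≤n n≤N) (sym (*-identityˡ _))
  A²≈aA⇒Aʲ⁺¹≈aʲA N A a A²≈aA (suc j) m n 1≤n n≤N = begin
    sumR N (λ l → A m l * matPow N A (suc j) l n)
      ≈⟨ sumR-cong N (λ l _ _ → *-cong refl (A²≈aA⇒Aʲ⁺¹≈aʲA N A a A²≈aA j l n 1≤n n≤N)) ⟩
    sumR N (λ l → A m l * (aʲ * A l n))  ≈⟨ sumR-cong N (λ l _ _ → x∙yz≈y∙xz (A m l) aʲ (A l n)) ⟩
    sumR N (λ l → aʲ * (A m l * A l n))  ≈⟨ sumR-distribˡ N aʲ _ ⟨
    aʲ * matMul N A A m n                ≈⟨ *-cong refl (A²≈aA m n) ⟩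
    aʲ * (a * A m n)                     ≈⟨ *-assoc _ _ _ ⟨
    aʲ * a * A m n                       ≈⟨ *-cong (*-comm aʲ a) refl ⟩
    powR a (suc j) * A m n               ∎
    where aʲ = powR a j

  A²≈aA⇒tr[Aʲ⁺¹]≈aʲtr[A] : ∀ N A a → (∀ m n → matMul N A A m n ≈ a * A m n) →
                           ∀ j → trace N (matPow N A (suc j)) ≈ powR a j * trace N A
  A²≈aA⇒tr[Aʲ⁺¹]≈aʲtr[A] N A a A²≈aA j =
    trans (sumR-cong N (λ i 1≤i i≤N → A²≈aA⇒Aʲ⁺¹≈aʲA N A a A²≈aA j i i 1≤i i≤N))
          (sym (sumR-distribˡ N _ _))

%ℕ-≡-mod : ∀ z x t N .{{_ : NonZero N}} → z ≡ + x ℤ.+ t ℤ.* + N →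
           + (z ℤ.%ℕ N) ≡ + x ℤ.+ (t ℤ.- z ℤ./ℕ N) ℤ.* + N
%ℕ-≡-mod z x t N z≡x+tN = begin
  + r                                ≡⟨ solve 3 (λ r q n → r := (r :+ q :* n) :- q :* n) ≡.refl (+ r) q (+ N) ⟩
  (+ r ℤ.+ q ℤ.* + N) ℤ.- q ℤ.* + N  ≡⟨ ≡.cong (ℤ._- q ℤ.* + N) (ℤD.a≡a%ℕn+[a/ℕn]*n z N) ⟨
  z ℤ.- q ℤ.* + N                    ≡⟨ ≡.cong (ℤ._- q ℤ.* + N) z≡x+tN ⟩
  (+ x ℤ.+ t ℤ.* + N) ℤ.- q ℤ.* + N  ≡⟨ solve 4 (λ x t q n → (x :+ t :* n) :- q :* n := x :+ (t :- q) :* n)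
                                              ≡.refl (+ x) t q (+ N) ⟩
  + x ℤ.+ (t ℤ.- q) ℤ.* + N          ∎
  where
  r = z ℤ.%ℕ N
  q = z ℤ./ℕ N
  open ≡.≡-Reasoning
  open +-*-Solver using (solve; _:=_; _:+_; _:*_; _:-_)

+-%ℕ-/ℕ-decomposition : ∀ z w N .{{_ : NonZero N}} →
                        z ℤ.+ w ≡ + (z ℤ.%ℕ N ℕ.+ w ℤ.%ℕ N) ℤ.+ (z ℤ./ℕ N ℤ.+ w ℤ./ℕ N) ℤ.* + N
+-%ℕ-/ℕ-decomposition z w N = begin
  z ℤ.+ w
    ≡⟨ ≡.cong₂ ℤ._+_ (ℤD.a≡a%ℕn+[a/ℕn]*n z N) (ℤD.a≡a%ℕn+[a/ℕn]*n w N) ⟩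
  (+ r ℤ.+ q ℤ.* + N) ℤ.+ (+ s ℤ.+ p ℤ.* + N)
    ≡⟨ solve 5 (λ r q s p n → (r :+ q :* n) :+ (s :+ p :* n) := (r :+ s) :+ (q :+ p) :* n)
               ≡.refl (+ r) q (+ s) p (+ N) ⟩
  (+ r ℤ.+ + s) ℤ.+ (q ℤ.+ p) ℤ.* + N
    ≡⟨ ≡.cong (ℤ._+ (q ℤ.+ p) ℤ.* + N) (ℤP.pos-+ r s) ⟨
  + (r ℕ.+ s) ℤ.+ (q ℤ.+ p) ℤ.* + N  ∎
  where
  r = z ℤ.%ℕ N
  s = w ℤ.%ℕ N
  q = z ℤ./ℕ N
  p = w ℤ./ℕ N
  open ≡.≡-Reasoning
  open +-*-Solver using (solve; _:=_; _:+_; _:*_)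

module RootOfUnity {c ℓ : Level} (R : CommutativeRing c ℓ) (N′ : ℕ) (ζ : CommutativeRing.Carrier R)
                   (ζᴺ≈1 : CommutativeRing._≈_ R (RingDefs.powR R ζ (suc N′)) (CommutativeRing.1# R)) where
  open CommutativeRing R
  open RingDefs R using (powR)
  open Sums R using (powR-+; powR-*-≈1)
  open +-*-Solver using (solve; _:=_; _:+_; _:*_; :-_; con)
  open import Relation.Binary.Reasoning.Setoid setoid

  N : ℕ
  N = suc N′

  -- Defs' eq ζ N q a is definitionally χ (+ divN N q ℤ.* a).
  χ : ℤ → Carrier
  χ z = powR ζ (modZ z N)

  powR-≈-mod : ∀ x y t → + x ≡ + y ℤ.+ t ℤ.* + N → powR ζ x ≈ powR ζ y
  powR-≈-mod x y (+ t) x≡y+tN = begin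
    powR ζ x                     ≡⟨ ≡.cong (powR ζ) (ℤP.+-injective (≡.trans x≡y+tN y+tN≡[y+tN])) ⟩
    powR ζ (y ℕ.+ t ℕ.* N)       ≈⟨ powR-+ ζ y (t ℕ.* N) ⟩
    powR ζ y * powR ζ (t ℕ.* N)  ≈⟨ *-cong refl (powR-*-≈1 ζ N ζᴺ≈1 t) ⟩
    powR ζ y * 1#                ≈⟨ *-identityʳ _ ⟩
    powR ζ y                     ∎
    where
    y+tN≡[y+tN] : + y ℤ.+ + t ℤ.* + N ≡ + (y ℕ.+ t ℕ.* N)
    y+tN≡[y+tN] = ≡.sym (≡.trans (ℤP.pos-+ y (t ℕ.* N)) (≡.cong (λ w → + y ℤ.+ w) (ℤP.pos-* t N)))
  powR-≈-mod x y -[1+ t ] x≡y-tN = sym (powR-≈-mod y x (+ suc t) y≡x+tN)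
    where
    y≡x+tN : + y ≡ + x ℤ.+ + suc t ℤ.* + N
    y≡x+tN = ≡.trans (solve 3 (λ y t n → y := (y :+ t :* n) :+ (:- t) :* n) ≡.refl (+ y) -[1+ t ] (+ N))
                     (≡.cong (λ z → z ℤ.+ + suc t ℤ.* + N) (≡.sym x≡y-tN))

  χ≈powR : ∀ z x t → z ≡ + x ℤ.+ t ℤ.* + N → χ z ≈ powR ζ x
  χ≈powR z x t z≡x+tN = powR-≈-mod (modZ z N) x (t ℤ.- z ℤ./ℕ N) (%ℕ-≡-mod z x t N z≡x+tN)

  χ-+ : ∀ z w → χ (z ℤ.+ w) ≈ χ z * χ w
  χ-+ z w = trans (χ≈powR (z ℤ.+ w) (modZ z N ℕ.+ modZ w N) (z ℤ./ℕ N ℤ.+ w ℤ./ℕ N)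
                          (+-%ℕ-/ℕ-decomposition z w N))
                  (powR-+ ζ (modZ z N) (modZ w N))

  χ-pos : ∀ x → χ (+ x) ≈ powR ζ x
  χ-pos x = χ≈powR (+ x) x (+ 0) (≡.sym (ℤP.+-identityʳ (+ x)))

  χ-multiple : ∀ t → χ (t ℤ.* + N) ≈ 1#
  χ-multiple t = χ≈powR (t ℤ.* + N) 0 t (≡.sym (ℤP.+-identityˡ (t ℤ.* + N)))

  χ-*-pos : ∀ z l → χ (z ℤ.* + l) ≈ powR (χ z) l
  χ-*-pos z zero    = reflexive (≡.cong χ (ℤP.*-zeroʳ z))
  χ-*-pos z (suc l) = begin
    χ (z ℤ.* + suc l)    ≡⟨ ≡.cong χ (solve 2 (λ z l → z :* (con (+ 1) :+ l) := z :+ z :* l) ≡.refl z (+ l)) ⟩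
    χ (z ℤ.+ z ℤ.* + l)  ≈⟨ χ-+ z (z ℤ.* + l) ⟩
    χ z * χ (z ℤ.* + l)  ≈⟨ *-cong refl (χ-*-pos z l) ⟩
    χ z * powR (χ z) l   ∎

  χ-neg : ∀ z → χ z ≈ 1# → χ (ℤ.- z) ≈ 1#
  χ-neg z χz≈1 = begin
    χ (ℤ.- z)          ≈⟨ *-identityʳ _ ⟨
    χ (ℤ.- z) * 1#     ≈⟨ *-cong refl χz≈1 ⟨
    χ (ℤ.- z) * χ z    ≈⟨ χ-+ (ℤ.- z) z ⟨
    χ (ℤ.- z ℤ.+ z)    ≡⟨ ≡.cong χ (ℤP.+-inverseˡ z) ⟩
    1#                 ∎

module Orthogonality {c ℓ : Level} (R : CommutativeRing c ℓ) (domain : RingDefs.IsDomain R)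
                     (N′ : ℕ) (ζ : CommutativeRing.Carrier R)
                     (ζ-primitive : RingDefs.IsPrimitiveRoot R ζ (suc N′)) where
  open CommutativeRing R
  open RingDefs R using (natR; sumR)
  open Sums R using (sumR-cong; sumR-distribˡ; sumR-const; sumR-powR≈0)
  open RootOfUnity R N′ ζ (proj₁ ζ-primitive) public
  open +-*-Solver using (solve; _:=_; _:+_; _:*_; _:-_; :-_)
  open import Relation.Binary.Reasoning.Setoid setoid

  χ-≉1 : ∀ d → 1 ≤ d → d < N → ¬ χ (+ d) ≈ 1#
  χ-≉1 d 1≤d d<N χd≈1 = proj₂ ζ-primitive d 1≤d d<N (trans (sym (χ-pos d)) χd≈1)

  χ-difference-≉1 : ∀ a b → 1 ≤ a → b ≤ N → a < b → ¬ χ (+ b ℤ.- + a) ≈ 1#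
  χ-difference-≉1 a b 1≤a b≤N a<b =
    ≡.subst (λ z → ¬ χ z ≈ 1#) (≡.sym b-a≡b∸a) (χ-≉1 (b ℕ.∸ a) (ℕP.m<n⇒0<n∸m a<b) b∸a<N)
    where
    b-a≡b∸a : + b ℤ.- + a ≡ + (b ℕ.∸ a)
    b-a≡b∸a = ≡.trans (ℤP.[+m]-[+n]≡m⊖n b a) (ℤP.⊖-≥ (ℕP.<⇒≤ a<b))
    b∸a<N : b ℕ.∸ a < N
    b∸a<N = ℕP.<-≤-trans (ℕP.∸-monoʳ-< 1≤a (ℕP.<⇒≤ a<b)) b≤N

  χ-distinct-≉1 : ∀ a b → 1 ≤ a → a ≤ N → 1 ≤ b → b ≤ N → a ≢ b → ¬ χ (+ b ℤ.- + a) ≈ 1#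
  χ-distinct-≉1 a b 1≤a a≤N 1≤b b≤N a≢b with ℕP.<-cmp a b
  ... | tri< a<b _ _ = χ-difference-≉1 a b 1≤a b≤N a<b
  ... | tri≈ _ a≡b _ = contradiction a≡b a≢b
  ... | tri> _ _ b<a = χ-difference-≉1 b a 1≤b a≤N b<a ∘ flip
    where
    flip : χ (+ b ℤ.- + a) ≈ 1# → χ (+ a ℤ.- + b) ≈ 1#
    flip χ[b-a]≈1 = trans (reflexive (≡.cong χ (solve 2 (λ b a → a :- b := :- (b :- a)) ≡.refl (+ b) (+ a))))
                          (χ-neg (+ b ℤ.- + a) χ[b-a]≈1)

  sumR-χ≈0 : ∀ z → ¬ χ z ≈ 1# → sumR N (λ l → χ (z ℤ.* + l)) ≈ 0#
  sumR-χ≈0 z χz≉1 = trans (sumR-cong N (λ l _ _ → χ-*-pos z l))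
    (sumR-powR≈0 domain N (χ z) (trans (sym (χ-*-pos z N)) (χ-multiple z)) χz≉1)

  orthogonality-equal : ∀ a m n →
    sumR N (λ l → χ (a ℤ.* (m ℤ.- + l)) * χ (a ℤ.* (+ l ℤ.- n))) ≈ natR N * χ (a ℤ.* (m ℤ.- n))
  orthogonality-equal a m n = trans (sumR-cong N (λ l _ _ → constant l)) (sumR-const N _)
    where
    constant : ∀ l → χ (a ℤ.* (m ℤ.- + l)) * χ (a ℤ.* (+ l ℤ.- n)) ≈ χ (a ℤ.* (m ℤ.- n))
    constant l = trans (sym (χ-+ (a ℤ.* (m ℤ.- + l)) (a ℤ.* (+ l ℤ.- n)))) (reflexive (≡.cong χ
      (solve 4 (λ a m l n → a :* (m :- l) :+ a :* (l :- n) := a :* (m :- n)) ≡.refl a m (+ l) n)))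

  orthogonality-distinct : ∀ a b m n → 1 ≤ a → a ≤ N → 1 ≤ b → b ≤ N → a ≢ b →
    sumR N (λ l → χ (+ a ℤ.* (m ℤ.- + l)) * χ (+ b ℤ.* (+ l ℤ.- n))) ≈ 0#
  orthogonality-distinct a b m n 1≤a a≤N 1≤b b≤N a≢b = begin
    sumR N (λ l → χ (+ a ℤ.* (m ℤ.- + l)) * χ (+ b ℤ.* (+ l ℤ.- n)))  ≈⟨ sumR-cong N (λ l _ _ → split l) ⟩
    sumR N (λ l → χ e * χ (d ℤ.* + l))                                 ≈⟨ sumR-distribˡ N (χ e) _ ⟨
    χ e * sumR N (λ l → χ (d ℤ.* + l))                                 ≈⟨ *-cong refl (sumR-χ≈0 d χd≉1) ⟩
    χ e * 0#                                                           ≈⟨ zeroʳ _ ⟩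
    0#                                                                 ∎
    where
    e = + a ℤ.* m ℤ.- + b ℤ.* n
    d = + b ℤ.- + a
    χd≉1 = χ-distinct-≉1 a b 1≤a a≤N 1≤b b≤N a≢b
    split : ∀ l → χ (+ a ℤ.* (m ℤ.- + l)) * χ (+ b ℤ.* (+ l ℤ.- n)) ≈ χ e * χ (d ℤ.* + l)
    split l = begin
      χ (+ a ℤ.* (m ℤ.- + l)) * χ (+ b ℤ.* (+ l ℤ.- n))  ≈⟨ χ-+ (+ a ℤ.* (m ℤ.- + l)) (+ b ℤ.* (+ l ℤ.- n)) ⟨
      χ (+ a ℤ.* (m ℤ.- + l) ℤ.+ + b ℤ.* (+ l ℤ.- n))    ≡⟨ ≡.cong χ
        (solve 5 (λ a m l b n → a :* (m :- l) :+ b :* (l :- n) := (a :* m :- b :* n) :+ (b :- a) :* l)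
                 ≡.refl (+ a) m (+ l) (+ b) n) ⟩
      χ (e ℤ.+ d ℤ.* + l)                                ≈⟨ χ-+ e (d ℤ.* + l) ⟩
      χ e * χ (d ℤ.* + l)                                ∎

divN-*-cancel : ∀ {N} q → q ∣ N → divN N q ℕ.* q ≡ N
divN-*-cancel zero    0∣N = ≡.sym (0∣⇒≡0 0∣N)
divN-*-cancel (suc q) q∣N = ℕD.m/n*n≡m q∣N

divisor-nonZero : ∀ {N} .{{_ : NonZero N}} q → q ∣ N → NonZero q
divisor-nonZero {N} zero    0∣N = contradiction (0∣⇒≡0 0∣N) (ℕ.≢-nonZero⁻¹ N)
divisor-nonZero     (suc q) _   = _

frequency : ℕ → ℕ → ℕ → ℕ
frequency N q k = divN N q ℕ.* k

frequency-positive : ∀ {N} .{{_ : NonZero N}} q k → q ∣ N → 1 ≤ k → 1 ≤ frequency N q k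
frequency-positive {N} q (suc k) q∣N _ with divN N q | divN-*-cancel q q∣N
... | zero  | 0≡N = contradiction (≡.sym 0≡N) (ℕ.≢-nonZero⁻¹ N)
... | suc _ | _   = s≤s z≤n

frequency-≤ : ∀ {N} q k → q ∣ N → k ≤ q → frequency N q k ≤ N
frequency-≤ {N} q k q∣N k≤q =
  ≡.subst (frequency N q k ≤_) (divN-*-cancel q q∣N) (ℕP.*-monoʳ-≤ (divN N q) k≤q)

frequency-injective : ∀ {N} .{{_ : NonZero N}} q k q′ k′ → q ∣ N → q′ ∣ N →
                      Coprime k q → Coprime k′ q′ →
                      frequency N q k ≡ frequency N q′ k′ → (q , k) ≡ (q′ , k′)
frequency-injective {N} q k q′ k′ q∣N q′∣N coprime coprime′ same = ≡.cong₂ _,_ q≡q′ k≡k′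
  where
  kq′≡k′q : k ℕ.* q′ ≡ k′ ℕ.* q
  kq′≡k′q = ℕP.*-cancelˡ-≡ _ _ N (begin
    N ℕ.* (k ℕ.* q′)                  ≡⟨ ≡.cong (ℕ._* (k ℕ.* q′)) (divN-*-cancel q q∣N) ⟨
    divN N q ℕ.* q ℕ.* (k ℕ.* q′)     ≡⟨ solve 4 (λ u q k q′ → u :* q :* (k :* q′) := u :* k :* (q :* q′))
                                                 ≡.refl (divN N q) q k q′ ⟩
    frequency N q k ℕ.* (q ℕ.* q′)    ≡⟨ ≡.cong (ℕ._* (q ℕ.* q′)) same ⟩
    frequency N q′ k′ ℕ.* (q ℕ.* q′)  ≡⟨ solve 4 (λ u q k q′ → u :* k :* (q :* q′) := u :* q′ :* (k :* q))
                                                 ≡.refl (divN N q′) q k′ q′ ⟩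
    divN N q′ ℕ.* q′ ℕ.* (k′ ℕ.* q)   ≡⟨ ≡.cong (ℕ._* (k′ ℕ.* q)) (divN-*-cancel q′ q′∣N) ⟩
    N ℕ.* (k′ ℕ.* q)                  ∎)
    where
    open ≡.≡-Reasoning
    open ℕSolver using (solve; _:=_; _:*_)
  q∣q′ : q ∣ q′
  q∣q′ = coprime-divisor (Coprime.sym coprime) (≡.subst (q ∣_) (≡.sym kq′≡k′q) (n∣m*n k′ {q}))
  q′∣q : q′ ∣ q
  q′∣q = coprime-divisor (Coprime.sym coprime′) (≡.subst (q′ ∣_) kq′≡k′q (n∣m*n k {q′}))
  q≡q′ : q ≡ q′
  q≡q′ = ∣-antisym q∣q′ q′∣q
  k≡k′ : k ≡ k′
  k≡k′ = ℕP.*-cancelʳ-≡ k k′ q′ {{divisor-nonZero q′ q′∣N}}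
           (≡.subst (λ x → k ℕ.* q′ ≡ k′ ℕ.* x) q≡q′ kq′≡k′q)

lcmUpTo-positive : ∀ Q → 0 < lcmUpTo Q
lcmUpTo-positive zero    = s≤s z≤n
lcmUpTo-positive (suc Q) = ℕP.n≢0⇒n>0 λ lcm≡0 →
  [ (λ ()) , ℕP.>⇒≢ (lcmUpTo-positive Q) ]′ (ℕP.m*n≡0⇒m≡0∨n≡0 (suc Q) (begin
    suc Q ℕ.* L                      ≡⟨ gcd*lcm (suc Q) L ⟨
    gcd (suc Q) L ℕ.* lcm (suc Q) L  ≡⟨ ≡.cong (gcd (suc Q) L ℕ.*_) lcm≡0 ⟩
    gcd (suc Q) L ℕ.* 0              ≡⟨ ℕP.*-zeroʳ (gcd (suc Q) L) ⟩
    0                                ∎))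
  where
  L = lcmUpTo Q
  open ≡.≡-Reasoning

∣-lcmUpTo : ∀ Q q → 1 ≤ q → q ≤ Q → q ∣ lcmUpTo Q
∣-lcmUpTo zero    q 1≤q q≤0 = contradiction (ℕP.≤-trans 1≤q q≤0) λ ()
∣-lcmUpTo (suc Q) q 1≤q q≤1+Q with q ℕ.≟ suc Q
... | yes ≡.refl = m∣lcm[m,n] (suc Q) (lcmUpTo Q)
... | no  q≢1+Q  = ∣-trans (∣-lcmUpTo Q q 1≤q (ℕP.≤-pred (ℕP.≤∧≢⇒< q≤1+Q q≢1+Q)))
                           (n∣lcm[m,n] (suc Q) (lcmUpTo Q))

-- Defs defines φ q as go q for a local function go that cannot be named here.
-- coprimeCount is go, obtained by unification: the no-branch of φ-unfold exposes the goal
-- go (suc k) k, and abstracting suc k in pinCoprimeCount turns it into go q k, which fixes the meta.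
mutual
  coprimeCount : ℕ → ℕ → ℕ
  coprimeCount = _

  CoprimeCountPin : ℕ → Set
  CoprimeCountPin = _

  φ-unfold : ∀ k → φ (suc k) ≡ φ (suc k)
  φ-unfold k with gcd (suc k) (suc k) ℕ.≟ 1
  ... | yes _ = ≡.refl
  ... | no  _ = pinCoprimeCount k

  pinCoprimeCount : ∀ k → CoprimeCountPin k
  pinCoprimeCount k with suc k
  ... | q = ≡.refl {x = coprimeCount q k}

φ≡coprimeCount : ∀ q → φ q ≡ coprimeCount q q
φ≡coprimeCount q = ≡.refl

coprimeCount-suc-coprime : ∀ q k → Coprime (suc k) q → coprimeCount q (suc k) ≡ suc (coprimeCount q k)
coprimeCount-suc-coprime q k coprime with gcd (suc k) q ℕ.≟ 1
... | yes _     = ≡.refl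
... | no  gcd≢1 = contradiction (coprime⇒gcd≡1 coprime) gcd≢1

coprimeCount-suc-not-coprime : ∀ q k → ¬ Coprime (suc k) q → coprimeCount q (suc k) ≡ coprimeCount q k
coprimeCount-suc-not-coprime q k ¬coprime with gcd (suc k) q ℕ.≟ 1
... | yes gcd≡1 = ⊥-elim (¬coprime (gcd≡1⇒coprime gcd≡1))
... | no  _     = ≡.refl

module RamanujanSums {c ℓ : Level} (R : CommutativeRing c ℓ) where
  open CommutativeRing R
  open RingDefs R using (sumR; ramanujan; eq)

  -- The summand of ramanujan is likewise local to Defs; ramanujan≡sumR determines it.
  mutual
    ramanujanTerm : Carrier → ℕ → ℕ → ℤ → ℕ → Carrier
    ramanujanTerm = _

    ramanujan≡sumR : ∀ ζ N q n → ramanujan ζ N q n ≡ sumR q (ramanujanTerm ζ N q n)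
    ramanujan≡sumR ζ N q n = ≡.refl

  ramanujanTerm-coprime : ∀ ζ N q n k → Coprime k q → ramanujanTerm ζ N q n k ≡ eq ζ N q (+ k ℤ.* n)
  ramanujanTerm-coprime ζ N q n k coprime with gcd k q ℕ.≟ 1
  ... | yes _     = ≡.refl
  ... | no  gcd≢1 = contradiction (coprime⇒gcd≡1 coprime) gcd≢1

  ramanujanTerm-not-coprime : ∀ ζ N q n k → ¬ Coprime k q → ramanujanTerm ζ N q n k ≡ 0#
  ramanujanTerm-not-coprime ζ N q n k ¬coprime with gcd k q ℕ.≟ 1
  ... | yes gcd≡1 = ⊥-elim (¬coprime (gcd≡1⇒coprime gcd≡1))
  ... | no  _     = ≡.refl

module RamanujanMatrix {c ℓ : Level} (R : CommutativeRing c ℓ) (domain : RingDefs.IsDomain R)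
                       (Q N′ : ℕ) (ζ : CommutativeRing.Carrier R)
                       (ζ-primitive : RingDefs.IsPrimitiveRoot R ζ (suc N′))
                       (∣N : ∀ q → 1 ≤ q → q ≤ Q → q ∣ suc N′) where
  open CommutativeRing R
  open RingDefs R using (natR; powR; sumR; ramanujan; Mat; matMul; matPow; trace)
  open Sums R
  open Matrices R using (A²≈aA⇒tr[Aʲ⁺¹]≈aʲtr[A])
  open RamanujanSums R
  open Orthogonality R domain N′ ζ ζ-primitive
  open import Algebra.Properties.CommutativeSemigroup *-commutativeSemigroup using (x∙yz≈y∙xz)
  open import Relation.Binary.Reasoning.Setoid setoid

  X : Mat
  X m n = sumR Q (λ q → ramanujan ζ N q (+ m ℤ.- + n))

  term : ℕ → ℕ → ℤ → Carrier
  term q k z = ramanujanTerm ζ N q z k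

  X≡sumTriangle : ∀ m n → X m n ≡ sumTriangle Q (λ q k → term q k (+ m ℤ.- + n))
  X≡sumTriangle m n = ≡.refl

  term-coprime : ∀ q k z → Coprime k q → term q k z ≈ χ (+ frequency N q k ℤ.* z)
  term-coprime q k z coprime = reflexive (≡.trans (ramanujanTerm-coprime ζ N q z k coprime)
    (≡.cong χ (≡.sym (≡.trans (≡.cong (ℤ._* z) (ℤP.pos-* (divN N q) k))
                              (ℤP.*-assoc (+ divN N q) (+ k) z)))))

  term-not-coprime : ∀ q k z → ¬ Coprime k q → term q k z ≈ 0#
  term-not-coprime q k z ¬coprime = reflexive (ramanujanTerm-not-coprime ζ N q z k ¬coprime)

  term-orthogonality-equal : ∀ q k m n →
    sumR N (λ l → term q k (m ℤ.- + l) * term q k (+ l ℤ.- n)) ≈ natR N * term q k (m ℤ.- n)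
  term-orthogonality-equal q k m n with coprime? k q
  ... | yes coprime = begin
    sumR N (λ l → term q k (m ℤ.- + l) * term q k (+ l ℤ.- n))
      ≈⟨ sumR-cong N (λ l _ _ → *-cong (term-coprime q k _ coprime) (term-coprime q k _ coprime)) ⟩
    sumR N (λ l → χ (a ℤ.* (m ℤ.- + l)) * χ (a ℤ.* (+ l ℤ.- n)))
      ≈⟨ orthogonality-equal a m n ⟩
    natR N * χ (a ℤ.* (m ℤ.- n))
      ≈⟨ *-cong refl (term-coprime q k _ coprime) ⟨
    natR N * term q k (m ℤ.- n)  ∎
    where a = + frequency N q k
  ... | no ¬coprime = begin
    sumR N (λ l → term q k (m ℤ.- + l) * term q k (+ l ℤ.- n))
      ≈⟨ sumR-zero N (λ l _ _ → trans (*-cong (term-not-coprime q k _ ¬coprime) refl) (zeroˡ _)) ⟩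
    0#                           ≈⟨ zeroʳ _ ⟨
    natR N * 0#                  ≈⟨ *-cong refl (term-not-coprime q k _ ¬coprime) ⟨
    natR N * term q k (m ℤ.- n)  ∎

  term-orthogonality-distinct : ∀ q k q′ k′ m n →
    1 ≤ k → k ≤ q → q ≤ Q → 1 ≤ k′ → k′ ≤ q′ → q′ ≤ Q → (q′ , k′) ≢ (q , k) →
    sumR N (λ l → term q k (m ℤ.- + l) * term q′ k′ (+ l ℤ.- n)) ≈ 0#
  term-orthogonality-distinct q k q′ k′ m n 1≤k k≤q q≤Q 1≤k′ k′≤q′ q′≤Q distinct
    with coprime? k q | coprime? k′ q′
  ... | yes coprime | yes coprime′ = trans
    (sumR-cong N (λ l _ _ → *-cong (term-coprime q k _ coprime) (term-coprime q′ k′ _ coprime′)))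
    (orthogonality-distinct (frequency N q k) (frequency N q′ k′) m n
      (frequency-positive q k q∣N 1≤k) (frequency-≤ q k q∣N k≤q)
      (frequency-positive q′ k′ q′∣N 1≤k′) (frequency-≤ q′ k′ q′∣N k′≤q′)
      (distinct ∘ ≡.sym ∘ frequency-injective q k q′ k′ q∣N q′∣N coprime coprime′))
    where
    q∣N  = ∣N q (ℕP.≤-trans 1≤k k≤q) q≤Q
    q′∣N = ∣N q′ (ℕP.≤-trans 1≤k′ k′≤q′) q′≤Q
  ... | no ¬coprime | _ =
    sumR-zero N (λ l _ _ → trans (*-cong (term-not-coprime q k _ ¬coprime) refl) (zeroˡ _))
  ... | yes _ | no ¬coprime′ =
    sumR-zero N (λ l _ _ → trans (*-cong refl (term-not-coprime q′ k′ _ ¬coprime′)) (zeroʳ _))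

  X² : ∀ m n → matMul N X X m n ≈ natR N * X m n
  X² m n = begin
    sumR N (λ l → X m l * X l n)
      ≈⟨ sumR-cong N (λ l _ _ → sumTriangle-* Q _ _) ⟩
    sumR N (λ l → sumTriangle Q (λ q k → sumTriangle Q (λ q′ k′ → product l q k q′ k′)))
      ≈⟨ sumR-sumTriangle N Q _ ⟩
    sumTriangle Q (λ q k → sumR N (λ l → sumTriangle Q (λ q′ k′ → product l q k q′ k′)))
      ≈⟨ sumTriangle-cong Q (λ q k _ _ _ → sumR-sumTriangle N Q _) ⟩
    sumTriangle Q (λ q k → sumTriangle Q (λ q′ k′ → sumR N (λ l → product l q k q′ k′)))
      ≈⟨ sumTriangle-cong Q diagonalOnly ⟩
    sumTriangle Q (λ q k → natR N * term q k (+ m ℤ.- + n))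
      ≈⟨ sumTriangle-distribˡ Q (natR N) _ ⟨
    natR N * X m n  ∎
    where
    product : ℕ → ℕ → ℕ → ℕ → ℕ → Carrier
    product l q k q′ k′ = term q k (+ m ℤ.- + l) * term q′ k′ (+ l ℤ.- + n)
    diagonalOnly : ∀ q k → 1 ≤ k → k ≤ q → q ≤ Q →
      sumTriangle Q (λ q′ k′ → sumR N (λ l → product l q k q′ k′)) ≈ natR N * term q k (+ m ℤ.- + n)
    diagonalOnly q k 1≤k k≤q q≤Q = trans
      (sumTriangle-single Q q k 1≤k k≤q q≤Q (λ q′ k′ 1≤k′ k′≤q′ q′≤Q →
         term-orthogonality-distinct q k q′ k′ (+ m) (+ n) 1≤k k≤q q≤Q 1≤k′ k′≤q′ q′≤Q))
      (term-orthogonality-equal q k (+ m) (+ n))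

  term-diagonal-coprime : ∀ q k i → Coprime k q → term q k (+ i ℤ.- + i) ≈ 1#
  term-diagonal-coprime q k i coprime = trans (term-coprime q k _ coprime) (χ≈powR _ 0 (+ 0)
    (solve 2 (λ a i → a :* (i :- i) := con (+ 0) :+ con (+ 0) :* con (+ N)) ≡.refl (+ frequency N q k) (+ i)))
    where open +-*-Solver using (solve; _:=_; _:+_; _:*_; _:-_; con)

  natR-coprimeCount : ∀ q k i → natR (coprimeCount q k) ≈ sumR k (λ k′ → term q k′ (+ i ℤ.- + i))
  natR-coprimeCount q zero    i = refl
  natR-coprimeCount q (suc k) i with coprime? (suc k) q
  ... | yes coprime = begin
    natR (coprimeCount q (suc k))  ≡⟨ ≡.cong natR (coprimeCount-suc-coprime q k coprime) ⟩
    1# + natR (coprimeCount q k)   ≈⟨ +-comm _ _ ⟩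
    natR (coprimeCount q k) + 1#
      ≈⟨ +-cong (natR-coprimeCount q k i) (sym (term-diagonal-coprime q (suc k) i coprime)) ⟩
    sumR (suc k) (λ k′ → term q k′ (+ i ℤ.- + i))  ∎
  ... | no ¬coprime = begin
    natR (coprimeCount q (suc k))  ≡⟨ ≡.cong natR (coprimeCount-suc-not-coprime q k ¬coprime) ⟩
    natR (coprimeCount q k)        ≈⟨ +-identityʳ _ ⟨
    natR (coprimeCount q k) + 0#
      ≈⟨ +-cong (natR-coprimeCount q k i) (sym (term-not-coprime q (suc k) _ ¬coprime)) ⟩
    sumR (suc k) (λ k′ → term q k′ (+ i ℤ.- + i))  ∎

  natR-Φ : ∀ Q → natR (Φ Q) ≈ sumR Q (λ q → natR (φ q))
  natR-Φ zero    = refl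
  natR-Φ (suc Q) = trans (natR-+ (φ (suc Q)) (Φ Q)) (trans (+-comm _ _) (+-cong (natR-Φ Q) refl))

  X-diagonal : ∀ i → X i i ≈ natR (Φ Q)
  X-diagonal i = begin
    X i i                                           ≡⟨ X≡sumTriangle i i ⟩
    sumTriangle Q (λ q k → term q k (+ i ℤ.- + i))  ≈⟨ sumR-cong Q (λ q _ _ → natR-coprimeCount q q i) ⟨
    sumR Q (λ q → natR (coprimeCount q q))
      ≈⟨ sumR-cong Q (λ q _ _ → reflexive (≡.cong natR (φ≡coprimeCount q))) ⟨
    sumR Q (λ q → natR (φ q))                       ≈⟨ natR-Φ Q ⟨
    natR (Φ Q)                                      ∎

  trace-matPow-X : ∀ j → trace N (matPow N X (suc j)) ≈ natR (N ℕ.^ suc j ℕ.* Φ Q)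
  trace-matPow-X j = begin
    trace N (matPow N X (suc j))            ≈⟨ A²≈aA⇒tr[Aʲ⁺¹]≈aʲtr[A] N X (natR N) X² j ⟩
    powR (natR N) j * sumR N (λ i → X i i)
      ≈⟨ *-cong (sym (natR-^ N j)) (trans (sumR-cong N (λ i _ _ → X-diagonal i)) (sumR-const N _)) ⟩
    natR (N ℕ.^ j) * (natR N * natR (Φ Q))  ≈⟨ x∙yz≈y∙xz _ _ _ ⟩
    natR N * (natR (N ℕ.^ j) * natR (Φ Q))  ≈⟨ *-assoc _ _ _ ⟨
    natR N * natR (N ℕ.^ j) * natR (Φ Q)    ≈⟨ *-cong (natR-* N (N ℕ.^ j)) refl ⟨
    natR (N ℕ.^ suc j) * natR (Φ Q)         ≈⟨ natR-* (N ℕ.^ suc j) (Φ Q) ⟨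
    natR (N ℕ.^ suc j ℕ.* Φ Q)              ∎

open import Data.Nat using (_^_; _*_)
open CommutativeRing using (Carrier; _≈_)
open RingDefs

trace-matPow-ramanujanMatrix :
  ∀ {c ℓ : Level} (R : CommutativeRing c ℓ) → IsDomain R →
  ∀ Q L → 0 < L → (∀ q → 1 ≤ q → q ≤ Q → q ∣ L) →
  (ζ : Carrier R) → IsPrimitiveRoot R ζ L → ∀ j →
  _≈_ R (trace R L (matPow R L (λ m n → sumR R Q (λ q → ramanujan R ζ L q (+ m ℤ.- + n))) (suc j)))
        (natR R (L ^ suc j * Φ Q))
trace-matPow-ramanujanMatrix R domain Q (suc N′) _ ∣L ζ ζ-primitive =
  RamanujanMatrix.trace-matPow-X R domain Q N′ ζ ζ-primitive ∣L

lemma8 : ∀ {c ℓ : Level} (R : CommutativeRing c ℓ) →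
    CharZero R → IsDomain R →
    (Q : ℕ) → 1 ≤ Q →
    (ζ : Carrier R) → IsPrimitiveRoot R ζ (lcmUpTo Q) →
    (j : ℕ) → 1 ≤ j →
    _≈_ R (trace R (lcmUpTo Q) (matPow R (lcmUpTo Q) (X R ζ Q) j))
    (natR R (lcmUpTo Q ^ j * Φ Q))
lemma8 R _ domain Q _ ζ ζ-primitive (suc j) _ =
  trace-matPow-ramanujanMatrix R domain Q (lcmUpTo Q) (lcmUpTo-positive Q) (∣-lcmUpTo Q) ζ ζ-primitive j
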